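{- Let $f(n,m)$ be the maximum, over all simple graphs with $n$ vertices and $m$ edges, of the number of unordered pairs of distinct edges sharing a common endpoint. Then for all $n$ and $m$, $$f(n,m) \le \frac{1}{2}nm +O\left(\frac{m^2}{n}\right).$$ -}

module Defs where

open import Data.Nat using (ℕ; zero; suc; _+_)
open import Data.Bool using (Bool; true; false; _∨_; if_then_else_)
open import Data.Fin using (Fin; toℕ; _≟_)
open import Data.Fin.Base using () renaming (_<_ to _<ᶠ_)
import Data.Fin.Properties as FinP
open import Data.List using (List; []; _∷_; allFin; concatMap; filter; length; map)
open import Data.Product using (_×_; _,_; proj₁; proj₂)
open import Relation.Binary.PropositionalEquality using (_≡_)
open import Relation.Nullary.Decidable using (⌊_⌋; _×-dec_)

record SimpleGraph (n : ℕ) : Set where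
  field
    adj   : Fin n → Fin n → Bool
    sym   : ∀ i j → adj i j ≡ adj j i
    irrefl : ∀ i → adj i i ≡ false
open SimpleGraph public

Edge : ℕ → Set
Edge n = Fin n × Fin n

-- The edges of G, each listed exactly once as a pair (i , j) with i < j.
edges : ∀ {n} → SimpleGraph n → List (Edge n)
edges {n} G =
  filter (λ e → FinP._<?_ (proj₁ e) (proj₂ e) ×-dec (adj G (proj₁ e) (proj₂ e) Data.Bool.≟ true))
    (concatMap (λ i → map (λ j → (i , j)) (allFin n)) (allFin n))

edgeCount : ∀ {n} → SimpleGraph n → ℕ
edgeCount G = length (edges G)

shareEndpoint : ∀ {n} → Edge n → Edge n → Bool
shareEndpoint (a , b) (c , d) =
  ⌊ a ≟ c ⌋ ∨ ⌊ a ≟ d ⌋ ∨ ⌊ b ≟ c ⌋ ∨ ⌊ b ≟ d ⌋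

count : ∀ {A : Set} → (A → Bool) → List A → ℕ
count p [] = 0
count p (x ∷ xs) = (if p x then 1 else 0) + count p xs

adjacentPairsList : ∀ {n} → List (Edge n) → ℕ
adjacentPairsList [] = 0
adjacentPairsList (e ∷ es) = count (shareEndpoint e) es + adjacentPairsList es

adjacentEdgePairs : ∀ {n} → SimpleGraph n → ℕ
adjacentEdgePairs G = adjacentPairsList (edges G)

module Submission where

-- Let L be the edge list of G (every edge listed once, as (i , j) with
-- i < j), m = |L|, P the number of unordered pairs of distinct edges
-- sharing an endpoint, and d x the number of edges of L at the vertex x.
-- The proof shows  2nP ≤ n²m + 4m²,  i.e. the corollary with C = 2:
--
--   (1) counting the ordered pairs (e , f) ∈ L × L sharing an endpoint
--       (the diagonal included) gives  2P + m = Σ_{e ∈ L} #{f ∈ L | f ~ e};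
--   (2) an edge sharing an endpoint with (a , b) is incident to a or to b,
--       so  #{f ∈ L | f ~ (a , b)} ≤ d a + d b;
--   (3) since d a , d b ≤ n we have (n - d a)(n - d b) ≥ 0, that is
--       n (d a + d b) ≤ n² + d a · d b;
--   (4) Σ_{(a , b) ∈ L} d a · d b ≤ (Σ_x d x)² = (2m)².
--
-- The bound d x ≤ n and step (4) only use that L is the list of
-- all pairs satisfying a decidable antisymmetric relation (an oriented
-- graph); the theorem is proved in that generality and then specialised.

open import Defs hiding (sym)
open import Data.Bool using (Bool; true; false; _∨_; if_then_else_) renaming (_≟_ to _≟ᵇ_)
open import Data.Bool.Properties using (∨-assoc)
open import Data.Empty using (⊥; ⊥-elim)
open import Data.Fin using (Fin; zero; suc; _≟_) renaming (_<_ to _<ᶠ_)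
import Data.Fin.Properties as Fin
open import Data.List using (List; []; _∷_; _++_; map; filter; concatMap; tabulate; length; allFin)
open import Data.Nat using (ℕ; _+_; _*_; _≤_; z≤n; s≤s)
open import Data.Nat.Properties hiding (_≟_)
open import Algebra.Properties.CommutativeSemigroup +-commutativeSemigroup using (interchange)
open import Algebra.Properties.Semiring.Sum +-*-semiring
  using (sum; sum-syntax; ∑-distrib-+; ∑-comm; *-distribˡ-sum; *-distribʳ-sum; sum-cong-≗)
open import Data.Nat.Tactic.RingSolver using (solve-∀)
open import Data.Product using (∃-syntax; _,_; proj₁; proj₂; _×_)
open import Relation.Binary.PropositionalEquality
open import Relation.Nullary using (Dec; yes; no; does)
open import Relation.Nullary.Decidable using (⌊_⌋; _×-dec_; ⌊⌋-map′)
open import Relation.Unary using (Decidable)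

∑-mono : ∀ {n} {f g : Fin n → ℕ} → (∀ i → f i ≤ g i) → sum f ≤ sum g
∑-mono {ℕ.zero}  f≤g = z≤n
∑-mono {ℕ.suc n} f≤g = +-mono-≤ (f≤g zero) (∑-mono (λ i → f≤g (suc i)))

∑-zero : ∀ n → ∑[ i < n ] 0 ≡ 0
∑-zero ℕ.zero    = refl
∑-zero (ℕ.suc n) = ∑-zero n

∑-ones : ∀ n → ∑[ i < n ] 1 ≡ n
∑-ones ℕ.zero    = refl
∑-ones (ℕ.suc n) = cong ℕ.suc (∑-ones n)

∑-pull-out : ∀ {n} c (f : Fin n → ℕ) → ∑[ i < n ] (f i * c) ≡ c * sum f
∑-pull-out {n} c f = trans (sum-cong-≗ {n} (λ i → *-comm (f i) c)) (sym (*-distribˡ-sum c f))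

∑∑-product : ∀ {n} (u v : Fin n → ℕ) → ∑[ i < n ] ∑[ j < n ] (u i * v j) ≡ sum u * sum v
∑∑-product u v = begin
  ∑[ i < _ ] ∑[ j < _ ] (u i * v j)  ≡⟨ sum-cong-≗ (λ i → sym (*-distribˡ-sum (u i) v)) ⟩
  ∑[ i < _ ] (u i * sum v)           ≡⟨ sym (*-distribʳ-sum (sum v) u) ⟩
  sum u * sum v                      ∎
  where open ≡-Reasoning

sumOver : ∀ {A : Set} → (A → ℕ) → List A → ℕ
sumOver g []       = 0
sumOver g (x ∷ xs) = g x + sumOver g xs

sumOver-mono : ∀ {A : Set} {f g : A → ℕ} (xs : List A) →
               (∀ x → f x ≤ g x) → sumOver f xs ≤ sumOver g xs
sumOver-mono []       f≤g = z≤n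
sumOver-mono (x ∷ xs) f≤g = +-mono-≤ (f≤g x) (sumOver-mono xs f≤g)

sumOver-+ : ∀ {A : Set} (f g : A → ℕ) (xs : List A) →
            sumOver (λ x → f x + g x) xs ≡ sumOver f xs + sumOver g xs
sumOver-+ f g []       = refl
sumOver-+ f g (x ∷ xs) =
  trans (cong (f x + g x +_) (sumOver-+ f g xs)) (interchange (f x) (g x) (sumOver f xs) (sumOver g xs))

sumOver-*ˡ : ∀ {A : Set} c (g : A → ℕ) (xs : List A) → c * sumOver g xs ≡ sumOver (λ x → c * g x) xs
sumOver-*ˡ c g []       = *-zeroʳ c
sumOver-*ˡ c g (x ∷ xs) = trans (*-distribˡ-+ c (g x) _) (cong (c * g x +_) (sumOver-*ˡ c g xs))

sumOver-const : ∀ {A : Set} c (xs : List A) → sumOver (λ _ → c) xs ≡ c * length xs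
sumOver-const c []       = sym (*-zeroʳ c)
sumOver-const c (x ∷ xs) = trans (cong (c +_) (sumOver-const c xs)) (sym (*-suc c _))

sumOver-++ : ∀ {A : Set} (g : A → ℕ) xs ys → sumOver g (xs ++ ys) ≡ sumOver g xs + sumOver g ys
sumOver-++ g []       ys = refl
sumOver-++ g (x ∷ xs) ys = trans (cong (g x +_) (sumOver-++ g xs ys)) (sym (+-assoc (g x) _ _))

sumOver-concatMap : ∀ {A B : Set} (g : B → ℕ) (F : A → List B) xs →
                    sumOver g (concatMap F xs) ≡ sumOver (λ x → sumOver g (F x)) xs
sumOver-concatMap g F []       = refl
sumOver-concatMap g F (x ∷ xs) =
  trans (sumOver-++ g (F x) _) (cong (sumOver g (F x) +_) (sumOver-concatMap g F xs))

sumOver-map : ∀ {A B : Set} (g : B → ℕ) (h : A → B) xs → sumOver g (map h xs) ≡ sumOver (λ x → g (h x)) xs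
sumOver-map g h []       = refl
sumOver-map g h (x ∷ xs) = cong (g (h x) +_) (sumOver-map g h xs)

sumOver-tabulate : ∀ {A : Set} n (g : A → ℕ) (f : Fin n → A) → sumOver g (tabulate f) ≡ ∑[ i < n ] g (f i)
sumOver-tabulate ℕ.zero    g f = refl
sumOver-tabulate (ℕ.suc n) g f = cong (g (f zero) +_) (sumOver-tabulate n g (λ i → f (suc i)))

sumOver-∑-comm : ∀ {A : Set} {n} (f : Fin n → A → ℕ) (xs : List A) →
                 ∑[ i < n ] sumOver (f i) xs ≡ sumOver (λ x → ∑[ i < n ] f i x) xs
sumOver-∑-comm {n = n} f []       = ∑-zero n
sumOver-∑-comm f (x ∷ xs) =
  trans (∑-distrib-+ (λ i → f i x) (λ i → sumOver (f i) xs))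
        (cong (sum (λ i → f i x) +_) (sumOver-∑-comm f xs))

ind : Bool → ℕ
ind b = if b then 1 else 0

ind≤1 : ∀ b → ind b ≤ 1
ind≤1 true  = ≤-refl
ind≤1 false = z≤n

ind-∨ : ∀ p q → ind (p ∨ q) ≤ ind p + ind q
ind-∨ true  q = s≤s z≤n
ind-∨ false q = ≤-refl

ind-*≤ : ∀ b x → ind b * x ≤ x
ind-*≤ true  x = ≤-reflexive (*-identityˡ x)
ind-*≤ false x = z≤n

ind-exclusive : ∀ {A B : Set} (a? : Dec A) (b? : Dec B) → (A → B → ⊥) →
                ind (does a?) + ind (does b?) ≤ 1
ind-exclusive (yes a) (yes b) a⇏b = ⊥-elim (a⇏b a b)
ind-exclusive (yes a) (no _)  a⇏b = ≤-refl
ind-exclusive (no _)  b?      a⇏b = ind≤1 (does b?)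

sumOver-filter : ∀ {A : Set} {P : A → Set} (P? : Decidable P) (g : A → ℕ) xs →
                 sumOver g (filter P? xs) ≡ sumOver (λ x → ind (does (P? x)) * g x) xs
sumOver-filter P? g []       = refl
sumOver-filter P? g (x ∷ xs) with does (P? x)
... | false = sumOver-filter P? g xs
... | true  = cong₂ _+_ (sym (*-identityˡ (g x))) (sumOver-filter P? g xs)

count-sumOver : ∀ {A : Set} (p : A → Bool) xs → count p xs ≡ sumOver (λ x → ind (p x)) xs
count-sumOver p []       = refl
count-sumOver p (x ∷ xs) = cong (ind (p x) +_) (count-sumOver p xs)

δ : ∀ {n} → Fin n → Fin n → ℕ
δ x i = ind ⌊ x ≟ i ⌋

∑-δ : ∀ {n} (x : Fin n) (f : Fin n → ℕ) → ∑[ i < n ] (δ x i * f i) ≡ f x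
∑-δ {ℕ.suc n} zero    f = trans (cong (f zero + 0 +_) (∑-zero n)) (trans (+-identityʳ _) (+-identityʳ _))
∑-δ {ℕ.suc n} (suc x) f = trans (sum-cong-≗ shift) (∑-δ x (λ i → f (suc i)))
  where
  shift : ∀ i → δ (suc x) (suc i) * f (suc i) ≡ δ x i * f (suc i)
  shift i = cong (λ b → ind b * f (suc i)) (⌊⌋-map′ (cong suc) Fin.suc-injective (x ≟ i))

incident : ∀ {n} → Fin n → Edge n → Bool
incident x f = ⌊ x ≟ proj₁ f ⌋ ∨ ⌊ x ≟ proj₂ f ⌋

degree : ∀ {n} → List (Edge n) → Fin n → ℕ
degree es x = count (incident x) es

≟-sym : ∀ {n} (a c : Fin n) → ⌊ a ≟ c ⌋ ≡ ⌊ c ≟ a ⌋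
≟-sym a c with a ≟ c | c ≟ a
... | yes _   | yes _   = refl
... | no  _   | no  _   = refl
... | yes a≡c | no  c≢a = ⊥-elim (c≢a (sym a≡c))
... | no  a≢c | yes c≡a = ⊥-elim (a≢c (sym c≡a))

shareEndpoint-refl : ∀ {n} (e : Edge n) → shareEndpoint e e ≡ true
shareEndpoint-refl (a , b) with a ≟ a
... | yes _   = refl
... | no  a≢a = ⊥-elim (a≢a refl)

shareEndpoint-sym : ∀ {n} (e f : Edge n) → shareEndpoint e f ≡ shareEndpoint f e
shareEndpoint-sym (a , b) (c , d)
  rewrite ≟-sym a c | ≟-sym a d | ≟-sym b c | ≟-sym b d =
  swap-middle ⌊ c ≟ a ⌋ ⌊ d ≟ a ⌋ ⌊ c ≟ b ⌋ ⌊ d ≟ b ⌋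
  where
  swap-middle : ∀ p q r s → p ∨ q ∨ r ∨ s ≡ p ∨ r ∨ q ∨ s
  swap-middle true  q     r     s = refl
  swap-middle false true  true  s = refl
  swap-middle false true  false s = refl
  swap-middle false false r     s = refl

shareEndpoint-incident : ∀ {n} (a b : Fin n) f →
  ind (shareEndpoint (a , b) f) ≤ ind (incident a f) + ind (incident b f)
shareEndpoint-incident a b (c , d) =
  subst (λ s → ind s ≤ ind (incident a (c , d)) + ind (incident b (c , d)))
        (∨-assoc ⌊ a ≟ c ⌋ ⌊ a ≟ d ⌋ (⌊ b ≟ c ⌋ ∨ ⌊ b ≟ d ⌋))
        (ind-∨ (incident a (c , d)) (incident b (c , d)))

shared≤degrees : ∀ {n} (es : List (Edge n)) a b →
  count (shareEndpoint (a , b)) es ≤ degree es a + degree es b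
shared≤degrees es a b = begin
  count (shareEndpoint (a , b)) es
    ≡⟨ count-sumOver _ es ⟩
  sumOver (λ f → ind (shareEndpoint (a , b) f)) es
    ≤⟨ sumOver-mono es (shareEndpoint-incident a b) ⟩
  sumOver (λ f → ind (incident a f) + ind (incident b f)) es
    ≡⟨ sumOver-+ _ _ es ⟩
  sumOver (λ f → ind (incident a f)) es + sumOver (λ f → ind (incident b f)) es
    ≡⟨ sym (cong₂ _+_ (count-sumOver _ es) (count-sumOver _ es)) ⟩
  degree es a + degree es b ∎
  where open ≤-Reasoning

-- Step (1): ordered pairs sharing an endpoint are twice the unordered
-- ones plus the diagonal.  The crossing term is symmetric because the
-- relation is.
cross-count : ∀ {n} (xs : List (Edge n)) y ys →
  sumOver (λ e → count (shareEndpoint e) (y ∷ ys)) xs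
    ≡ count (shareEndpoint y) xs + sumOver (λ e → count (shareEndpoint e) ys) xs
cross-count []       y ys = refl
cross-count (x ∷ xs) y ys rewrite cross-count xs y ys | shareEndpoint-sym x y =
  interchange (ind (shareEndpoint y x)) (count (shareEndpoint x) ys) (count (shareEndpoint y) xs) _

double-count : ∀ {n} (es : List (Edge n)) →
  sumOver (λ e → count (shareEndpoint e) es) es ≡ 2 * adjacentPairsList es + length es
double-count []       = refl
double-count (e ∷ es)
  rewrite shareEndpoint-refl e | cross-count es e es | double-count es =
  regroup (count (shareEndpoint e) es) (adjacentPairsList es) (length es)
  where
  regroup : ∀ c p l → (1 + c) + (c + (2 * p + l)) ≡ 2 * (c + p) + ℕ.suc l
  regroup = solve-∀

handshake : ∀ {n} (es : List (Edge n)) → ∑[ x < n ] degree es x ≤ 2 * length es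
handshake {n} es = begin
  ∑[ x < n ] degree es x
    ≡⟨ sum-cong-≗ (λ x → count-sumOver (incident x) es) ⟩
  ∑[ x < n ] sumOver (λ f → ind (incident x f)) es
    ≡⟨ sumOver-∑-comm (λ x f → ind (incident x f)) es ⟩
  sumOver (λ f → ∑[ x < n ] ind (incident x f)) es
    ≤⟨ sumOver-mono es ends ⟩
  sumOver (λ _ → 2) es
    ≡⟨ sumOver-const 2 es ⟩
  2 * length es ∎
  where
  open ≤-Reasoning
  ones : ∀ (a : Fin n) → ∑[ x < n ] ind ⌊ x ≟ a ⌋ ≡ 1
  ones a = trans (sum-cong-≗ (λ x → trans (cong ind (≟-sym x a)) (sym (*-identityʳ (δ a x)))))
                 (∑-δ a (λ _ → 1))
  ends : ∀ f → ∑[ x < n ] ind (incident x f) ≤ 2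
  ends (a , b) = begin
    ∑[ x < n ] ind (incident x (a , b))       ≤⟨ ∑-mono (λ x → ind-∨ ⌊ x ≟ a ⌋ ⌊ x ≟ b ⌋) ⟩
    ∑[ x < n ] (ind ⌊ x ≟ a ⌋ + ind ⌊ x ≟ b ⌋) ≡⟨ ∑-distrib-+ (λ x → ind ⌊ x ≟ a ⌋) (λ x → ind ⌊ x ≟ b ⌋) ⟩
    ∑[ x < n ] ind ⌊ x ≟ a ⌋ + ∑[ x < n ] ind ⌊ x ≟ b ⌋ ≡⟨ cong₂ _+_ (ones a) (ones b) ⟩
    2 ∎

-- Step (3): for x , y ≤ n,  n (x + y) ≤ n² + x y,  as (n - x)(n - y) ≥ 0.
n[x+y]≤n²+xy : ∀ n x y → x ≤ n → y ≤ n → n * (x + y) ≤ n * n + x * y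
n[x+y]≤n²+xy n x y x≤n y≤n with k , refl ← m≤n⇒∃[o]m+o≡n x≤n = begin
  (x + k) * (x + y)            ≡⟨ expand x k y ⟩
  (x + k) * x + x * y + k * y  ≤⟨ +-monoʳ-≤ ((x + k) * x + x * y) (*-monoʳ-≤ k y≤n) ⟩
  (x + k) * x + x * y + k * (x + k) ≡⟨ collect x k y ⟩
  (x + k) * (x + k) + x * y    ∎
  where
  open ≤-Reasoning
  expand : ∀ x k y → (x + k) * (x + y) ≡ (x + k) * x + x * y + k * y
  expand = solve-∀
  collect : ∀ x k y → (x + k) * x + x * y + k * (x + k) ≡ (x + k) * (x + k) + x * y
  collect = solve-∀

pairs≤degreeSums : ∀ {n} (es : List (Edge n)) →
  2 * adjacentPairsList es + length es ≤ sumOver (λ e → degree es (proj₁ e) + degree es (proj₂ e)) es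
pairs≤degreeSums es = begin
  2 * adjacentPairsList es + length es               ≡⟨ sym (double-count es) ⟩
  sumOver (λ e → count (shareEndpoint e) es) es      ≤⟨ sumOver-mono es (λ e → shared≤degrees es (proj₁ e) (proj₂ e)) ⟩
  sumOver (λ e → degree es (proj₁ e) + degree es (proj₂ e)) es ∎
  where open ≤-Reasoning

allPairs : ∀ n → List (Edge n)
allPairs n = concatMap (λ i → map (λ j → (i , j)) (allFin n)) (allFin n)

module OrientedGraph {n : ℕ} {R : Edge n → Set} (R? : Decidable R)
                     (antisym : ∀ i j → R (i , j) → R (j , i) → ⊥) where

  arcs : List (Edge n)
  arcs = filter R? (allPairs n)

  arc : Fin n → Fin n → ℕ
  arc i j = ind (does (R? (i , j)))

  sumOver-arcs : ∀ g → sumOver g arcs ≡ ∑[ i < n ] ∑[ j < n ] (arc i j * g (i , j))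
  sumOver-arcs g = begin
    sumOver g arcs
      ≡⟨ sumOver-filter R? g (allPairs n) ⟩
    sumOver (λ e → ind (does (R? e)) * g e) (allPairs n)
      ≡⟨ sumOver-concatMap _ (λ i → map (λ j → (i , j)) (allFin n)) (allFin n) ⟩
    sumOver (λ i → sumOver (λ e → ind (does (R? e)) * g e) (map (λ j → (i , j)) (allFin n))) (allFin n)
      ≡⟨ sumOver-tabulate n _ (λ i → i) ⟩
    ∑[ i < n ] sumOver (λ e → ind (does (R? e)) * g e) (map (λ j → (i , j)) (allFin n))
      ≡⟨ sum-cong-≗ {n} (λ i → trans (sumOver-map _ (λ j → (i , j)) (allFin n)) (sumOver-tabulate n _ (λ j → j))) ⟩
    ∑[ i < n ] ∑[ j < n ] (arc i j * g (i , j)) ∎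
    where open ≡-Reasoning

  sumOver-arcs-≤ : ∀ g → sumOver g arcs ≤ ∑[ i < n ] ∑[ j < n ] g (i , j)
  sumOver-arcs-≤ g = ≤-trans (≤-reflexive (sumOver-arcs g))
    (∑-mono (λ i → ∑-mono (λ j → ind-*≤ (does (R? (i , j))) (g (i , j)))))

  out-arcs : ∀ x → sumOver (λ e → δ x (proj₁ e)) arcs ≡ ∑[ j < n ] arc x j
  out-arcs x = begin
    sumOver (λ e → δ x (proj₁ e)) arcs     ≡⟨ sumOver-arcs _ ⟩
    ∑[ i < n ] ∑[ j < n ] (arc i j * δ x i) ≡⟨ sum-cong-≗ {n} (λ i → ∑-pull-out (δ x i) (arc i)) ⟩
    ∑[ i < n ] (δ x i * ∑[ j < n ] arc i j) ≡⟨ ∑-δ x (λ i → ∑[ j < n ] arc i j) ⟩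
    ∑[ j < n ] arc x j                      ∎
    where open ≡-Reasoning

  in-arcs : ∀ x → sumOver (λ e → δ x (proj₂ e)) arcs ≡ ∑[ i < n ] arc i x
  in-arcs x = begin
    sumOver (λ e → δ x (proj₂ e)) arcs      ≡⟨ sumOver-arcs _ ⟩
    ∑[ i < n ] ∑[ j < n ] (arc i j * δ x j) ≡⟨ ∑-comm (λ i j → arc i j * δ x j) ⟩
    ∑[ j < n ] ∑[ i < n ] (arc i j * δ x j) ≡⟨ sum-cong-≗ {n} (λ j → ∑-pull-out (δ x j) (λ i → arc i j)) ⟩
    ∑[ j < n ] (δ x j * ∑[ i < n ] arc i j) ≡⟨ ∑-δ x (λ j → ∑[ i < n ] arc i j) ⟩
    ∑[ i < n ] arc i x                      ∎
    where open ≡-Reasoning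

  -- By antisymmetry each vertex is joined to x by at most one arc.
  degree≤n : ∀ x → degree arcs x ≤ n
  degree≤n x = begin
    degree arcs x
      ≡⟨ count-sumOver (incident x) arcs ⟩
    sumOver (λ e → ind (incident x e)) arcs
      ≤⟨ sumOver-mono arcs (λ e → ind-∨ ⌊ x ≟ proj₁ e ⌋ ⌊ x ≟ proj₂ e ⌋) ⟩
    sumOver (λ e → δ x (proj₁ e) + δ x (proj₂ e)) arcs
      ≡⟨ sumOver-+ _ _ arcs ⟩
    sumOver (λ e → δ x (proj₁ e)) arcs + sumOver (λ e → δ x (proj₂ e)) arcs
      ≡⟨ cong₂ _+_ (out-arcs x) (in-arcs x) ⟩
    ∑[ j < n ] arc x j + ∑[ j < n ] arc j x
      ≡⟨ sym (∑-distrib-+ (arc x) (λ j → arc j x)) ⟩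
    ∑[ j < n ] (arc x j + arc j x)
      ≤⟨ ∑-mono (λ j → ind-exclusive (R? (x , j)) (R? (j , x)) (antisym x j)) ⟩
    ∑[ j < n ] 1
      ≡⟨ ∑-ones n ⟩
    n ∎
    where open ≤-Reasoning

  degree-products : sumOver (λ e → degree arcs (proj₁ e) * degree arcs (proj₂ e)) arcs
                      ≤ 2 * length arcs * (2 * length arcs)
  degree-products = begin
    sumOver (λ e → d (proj₁ e) * d (proj₂ e)) arcs ≤⟨ sumOver-arcs-≤ (λ e → d (proj₁ e) * d (proj₂ e)) ⟩
    ∑[ i < n ] ∑[ j < n ] (d i * d j)              ≡⟨ ∑∑-product d d ⟩
    sum d * sum d                                  ≤⟨ *-mono-≤ (handshake arcs) (handshake arcs) ⟩
    2 * length arcs * (2 * length arcs)            ∎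
    where
    open ≤-Reasoning
    d : Fin n → ℕ
    d = degree arcs

  degreeSums-bound : n * sumOver (λ e → degree arcs (proj₁ e) + degree arcs (proj₂ e)) arcs
                       ≤ n * n * length arcs + 2 * 2 * (length arcs * length arcs)
  degreeSums-bound = begin
    n * sumOver (λ e → d (proj₁ e) + d (proj₂ e)) arcs
      ≡⟨ sumOver-*ˡ n _ arcs ⟩
    sumOver (λ e → n * (d (proj₁ e) + d (proj₂ e))) arcs
      ≤⟨ sumOver-mono arcs (λ e → n[x+y]≤n²+xy n _ _ (degree≤n (proj₁ e)) (degree≤n (proj₂ e))) ⟩
    sumOver (λ e → n * n + d (proj₁ e) * d (proj₂ e)) arcs
      ≡⟨ sumOver-+ _ _ arcs ⟩
    sumOver (λ _ → n * n) arcs + sumOver (λ e → d (proj₁ e) * d (proj₂ e)) arcs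
      ≤⟨ +-mono-≤ (≤-reflexive (sumOver-const (n * n) arcs)) degree-products ⟩
    n * n * m + 2 * m * (2 * m)
      ≡⟨ cong (n * n * m +_) (square-double m) ⟩
    n * n * m + 2 * 2 * (m * m) ∎
    where
    open ≤-Reasoning
    d : Fin n → ℕ
    d = degree arcs
    m : ℕ
    m = length arcs
    square-double : ∀ m → 2 * m * (2 * m) ≡ 2 * 2 * (m * m)
    square-double = solve-∀

  adjacentPairs-bound : 2 * n * adjacentPairsList arcs
                          ≤ n * n * length arcs + 2 * 2 * (length arcs * length arcs)
  adjacentPairs-bound = begin
    2 * n * P                 ≡⟨ cong (_* P) (*-comm 2 n) ⟩
    n * 2 * P                 ≡⟨ *-assoc n 2 P ⟩
    n * (2 * P)               ≤⟨ *-monoʳ-≤ n (m≤m+n (2 * P) (length arcs)) ⟩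
    n * (2 * P + length arcs) ≤⟨ *-monoʳ-≤ n (pairs≤degreeSums arcs) ⟩
    n * sumOver (λ e → degree arcs (proj₁ e) + degree arcs (proj₂ e)) arcs ≤⟨ degreeSums-bound ⟩
    n * n * length arcs + 2 * 2 * (length arcs * length arcs) ∎
    where
    open ≤-Reasoning
    P : ℕ
    P = adjacentPairsList arcs

corollary1 : ∃[ C ] ((n : ℕ) → (G : SimpleGraph n) →
    2 * n * adjacentEdgePairs G
    ≤ n * n * edgeCount G + 2 * C * (edgeCount G * edgeCount G))
corollary1 = 2 , λ n G →
  OrientedGraph.adjacentPairs-bound (edge? G) (λ i j (i<j , _) (j<i , _) → Fin.<-asym i<j j<i)
  where
  edge? : ∀ {n} (G : SimpleGraph n) →
          Decidable (λ (e : Edge n) → (proj₁ e <ᶠ proj₂ e) × (adj G (proj₁ e) (proj₂ e) ≡ true))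
  edge? G e = Fin._<?_ (proj₁ e) (proj₂ e) ×-dec (adj G (proj₁ e) (proj₂ e) ≟ᵇ true)
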